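{- Let $k\geq2$ and let $H_e(M,2^r3^s,l)=\langle M,z\mid z^{2^r3^s}=1,\ x^z=x^l\ \forall x\in M\rangle$ be of type $e$. If $H_e(M,2^r3^s,l)$ is a CI-group and has the $k$-if property, then $\langle z\rangle\cong\mathbb{Z}_e$, where $e\in\{2,3,4,6\}$ is the type.
   Context: Definition of $H_e(M,2^r3^s,l)$: let $M$ be a finite abelian group all of whose Sylow subgroups are homocyclic, $m$ the exponent of $M$, $l$ an integer with $1\leq l\leq m$ and $\gcd(l(l-1),m)=1$, and $e$ the least positive integer with $l^e\equiv1\pmod m$. Let $r,s\geq0$ be integers such that one of the following holds: $e=2$, $r\geq1$, $s=0$, $m$ odd; $e=3$, $r=0$, $s\geq1$, $3\nmid m$; $e=4$, $r\geq2$, $s=0$, $m$ odd; $e=6$, $r\geq1$, $s\geq1$, $\gcd(m,6)=1$. Then $H_e(M,2^r3^s,l)$ is the group presented above (the semidirect product $M\rtimes\langle z\rangle$), said to be of type $e$. For a finite group $G$ let $G^*=G\setminus\{1\}$; for inverse-closed $S\subseteq G^*$, $\mathrm{Cay}(G,S)$ has vertex set $G$ and edges $\{h,g\}$ with $gh^{ -1}\in S$. $G$ is a CI-group if for all inverse-closed $S,T\subseteq G^*$, $\mathrm{Cay}(G,S)\cong\mathrm{Cay}(G,T)$ implies $T=S^{\alpha}$ for some $\alpha\in\mathrm{Aut}(G)$. A partition of a set is a collection of non-empty pairwise disjoint subsets whose union is the set. $\mathrm{Cay}(G,S)$ is a $k$-if Cayley graph if there is a partition $\{S_0=S,\dots,S_{k-1}\}$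 of $G^*$ into inverse-closed subsets with $\mathrm{Cay}(G,S_i)\cong\mathrm{Cay}(G,S)$ for all $i$; $G$ has the $k$-if property if some $\mathrm{Cay}(G,S)$ is a $k$-if Cayley graph. -}

module Defs where

open import Data.Nat using (ℕ; zero; suc; _+_; _*_; _∸_; _^_; _≤_; NonZero)
open import Data.Nat.Properties using (m^n≢0; m*n≢0)
open import Data.Nat.DivMod using (_mod_)
open import Data.Nat.Divisibility using (_∣_)
open import Data.Nat.Primality using (Prime; prime⇒nonZero)
open import Data.Fin using (Fin; toℕ)
open import Data.Bool using (Bool; true; false)
open import Data.Unit using (⊤; tt)
open import Data.Product using (Σ; Σ-syntax; ∃; ∃-syntax; _×_; _,_)
open import Data.List using (List; []; _∷_)
open import Data.List.Membership.Propositional using (_∈_)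
open import Relation.Binary.PropositionalEquality using (_≡_; _≢_)
open import Function.Bundles using (_↔_; Inverse)

record GroupOps : Set₁ where
  field
    Carrier : Set
    _∙_     : Carrier → Carrier → Carrier
    ε       : Carrier
    _⁻¹     : Carrier → Carrier

module _ (G : GroupOps) where
  open GroupOps G

  Subset : Set
  Subset = Carrier → Bool

  InverseClosed : Subset → Set
  InverseClosed S = ∀ g → S g ≡ true → S (g ⁻¹) ≡ true

  ConnSet : Subset → Set
  ConnSet S = (S ε ≡ false) × InverseClosed S

  -- Cay(G,S) has vertex set G and edge {h,g} iff g h⁻¹ ∈ S.
  -- Cay(G,S) ≅ Cay(G,T): a bijection of G preserving adjacency and non-adjacency.
  CayIso : Subset → Subset → Set
  CayIso S T = Σ[ φ ∈ Carrier ↔ Carrier ]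
    (∀ g h → S (g ∙ (h ⁻¹)) ≡ T (Inverse.to φ g ∙ (Inverse.to φ h ⁻¹)))

  IsAut : Carrier ↔ Carrier → Set
  IsAut α = ∀ g h → Inverse.to α (g ∙ h) ≡ Inverse.to α g ∙ Inverse.to α h

  -- G is a CI-group; T = S^α  means  T = { α s | s ∈ S }
  IsCIGroup : Set
  IsCIGroup = ∀ (S T : Subset) → ConnSet S → ConnSet T → CayIso S T →
    Σ[ α ∈ Carrier ↔ Carrier ] (IsAut α × (∀ g → T (Inverse.to α g) ≡ S g))

  IsPartitionOfG* : (k : ℕ) → (Fin k → Subset) → Set
  IsPartitionOfG* k P =
      (∀ i → P i ε ≡ false)
    × (∀ i → ∃[ g ] P i g ≡ true)
    × (∀ i j g → P i g ≡ true → P j g ≡ true → i ≡ j)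
    × (∀ g → g ≢ ε → ∃[ i ] P i g ≡ true)

  IsKIfCayley : (k : ℕ) → Subset → Set
  IsKIfCayley k S = Σ[ P ∈ (Fin k → Subset) ]
      (∃[ i₀ ] (∀ g → P i₀ g ≡ S g))
    × IsPartitionOfG* k P
    × (∀ i → InverseClosed (P i))
    × (∀ i → CayIso (P i) S)

  HasKIfProperty : ℕ → Set
  HasKIfProperty k = ∃[ S ] IsKIfCayley k S

  pow : Carrier → ℕ → Carrier
  pow g zero    = ε
  pow g (suc d) = g ∙ pow g d

  -- g has order d, i.e. ⟨g⟩ ≅ ℤ_d
  HasOrder : Carrier → ℕ → Set
  HasOrder g d = (1 ≤ d) × (pow g d ≡ ε) × (∀ d' → 1 ≤ d' → pow g d' ≡ ε → d ≤ d')

module _ {q : ℕ} .{{_ : NonZero q}} where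
  zeroZ : Fin q
  zeroZ = 0 mod q

  addZ : Fin q → Fin q → Fin q
  addZ x y = (toℕ x + toℕ y) mod q

  negZ : Fin q → Fin q
  negZ x = (q ∸ toℕ x) mod q

  smulZ : ℕ → Fin q → Fin q
  smulZ c x = (c * toℕ x) mod q

-- The finite abelian group M, given (up to isomorphism) as a direct
-- product  ℤ_{p₁^{a₁}} × ⋯ × ℤ_{p_t^{a_t}}  of cyclic groups of prime-power order.

record PrimePower : Set where
  field
    p       : ℕ
    a       : ℕ
    isPrime : Prime p
    a≥1     : 1 ≤ a

open PrimePower public

modulus : PrimePower → ℕ
modulus c = p c ^ a c

modulus-nonZero : ∀ c → NonZero (modulus c)
modulus-nonZero c = m^n≢0 (p c) (a c) {{prime⇒nonZero (isPrime c)}}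

Elt : List PrimePower → Set
Elt []       = ⊤
Elt (c ∷ cs) = Fin (modulus c) × Elt cs

zeroM : ∀ {cs} → Elt cs
zeroM {[]}     = tt
zeroM {c ∷ cs} = zeroZ {{modulus-nonZero c}} , zeroM

addM : ∀ {cs} → Elt cs → Elt cs → Elt cs
addM {[]}     _        _        = tt
addM {c ∷ cs} (x , xs) (y , ys) = addZ {{modulus-nonZero c}} x y , addM xs ys

negM : ∀ {cs} → Elt cs → Elt cs
negM {[]}     _        = tt
negM {c ∷ cs} (x , xs) = negZ {{modulus-nonZero c}} x , negM xs

smulM : ∀ {cs} → ℕ → Elt cs → Elt cs
smulM {[]}     _ _        = tt
smulM {c ∷ cs} n (x , xs) = smulZ {{modulus-nonZero c}} n x , smulM n xs

Homocyclic : List PrimePower → Set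
Homocyclic cs = ∀ {c d} → c ∈ cs → d ∈ cs → p c ≡ p d → a c ≡ a d

IsExponent : List PrimePower → ℕ → Set
IsExponent cs m = (1 ≤ m) × (∀ x → smulM {cs} m x ≡ zeroM)
  × (∀ m' → 1 ≤ m' → (∀ x → smulM {cs} m' x ≡ zeroM) → m ≤ m')

-- H_e(M, 2^r 3^s, l) = M ⋊ ⟨z⟩,  z of order 2^r 3^s,  z⁻¹ x z = x^l.
-- The element (i , x) stands for z^i x  (written additively in M), so
--   (z^i x)(z^j y) = z^{i+j} (z^{-j} x z^j) y = z^{i+j} x^{l^j} y.

zOrder : ℕ → ℕ → ℕ
zOrder r s = 2 ^ r * 3 ^ s

zOrder-nonZero : ∀ r s → NonZero (zOrder r s)
zOrder-nonZero r s =
  m*n≢0 (2 ^ r) (3 ^ s) {{m^n≢0 2 r}} {{m^n≢0 3 s}}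

H : (cs : List PrimePower) (r s l : ℕ) → GroupOps
H cs r s l = record
  { Carrier = Fin (zOrder r s) × Elt cs
  ; _∙_     = λ { (i , x) (j , y) → addZ {{nz}} i j , addM (smulM (l ^ toℕ j) x) y }
  ; ε       = zeroZ {{nz}} , zeroM
  ; _⁻¹     = λ { (i , x) → negZ {{nz}} i , negM (smulM (l ^ toℕ (negZ {{nz}} i)) x) }
  }
  where nz = zOrder-nonZero r s

zGen : (cs : List PrimePower) (r s l : ℕ) → GroupOps.Carrier (H cs r s l)
zGen cs r s l = (1 mod zOrder r s) {{zOrder-nonZero r s}} , zeroM

IsMultOrder : ℕ → ℕ → ℕ → Set
IsMultOrder l m e = (1 ≤ e) × (m ∣ l ^ e ∸ 1)
  × (∀ e' → 1 ≤ e' → m ∣ l ^ e' ∸ 1 → e ≤ e')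

{-# OPTIONS --safe #-}
-- Write n = 2^r 3^s for the order of z.  If n ≠ e, then n = p·h with p ∈ {2,3}
-- and e ∣ h, so l^h ≡ 1 (mod m) and z^h is central of order p.  As
-- gcd(l − 1, m) = 1, every element commuting with z lies in ⟨z⟩; hence each
-- automorphism maps z^h to a non-trivial element of order p of ⟨z⟩, namely
-- z^h or z^(−h).  In a CI-group every block of a k-if partition is the preimage
-- of the inverse-closed set S under an automorphism, so z^h lies in all k ≥ 2
-- blocks or in none, whereas it lies in exactly one.
module Submission where

open import Defs
open import Data.Nat
  using (ℕ; zero; suc; _+_; _*_; _∸_; _^_; _≤_; _<_; z≤n; s≤s; NonZero; _%_; ≢-nonZero⁻¹; >-nonZero; >-nonZero⁻¹)
open import Data.Nat.Properties hiding (0≢1+n)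
open import Data.Nat.DivMod
  using (_mod_; _/_; m%n<n; m≡m%n+[m/n]*n; n%n≡0; m%n%n≡m%n; %-distribˡ-+; %-distribˡ-*; [m+kn]%n≡m%n; m<n⇒m%n≡m)
open import Data.Nat.Divisibility
  using (_∣_; divides; ∣-trans; 1∣_; n∣m*n; *-monoʳ-∣; *-pres-∣; *-cancelˡ-∣; m%n≡0⇒n∣m; n∣m⇒m%n≡0; ∣⇒≤)
open import Data.Nat.GCD using (gcd)
open import Data.Nat.Coprimality
  using (Coprime; coprime-divisor; gcd≡1⇒coprime) renaming (sym to coprime-sym)
open import Data.Fin using (Fin; toℕ; zero; suc)
open import Data.Fin.Properties using (toℕ-fromℕ<; toℕ-injective; toℕ<n; 0≢1+n)
open import Data.Bool using (true)
open import Data.Bool.Properties using (⇔→≡)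
open import Data.List using (List; []; _∷_)
open import Data.List.Relation.Unary.All as All using (All; []; _∷_)
open import Data.Product using (_×_; _,_; proj₁; proj₂; ∃₂)
open import Data.Sum as Sum using (_⊎_; inj₁; inj₂)
open import Data.Empty using (⊥-elim)
open import Function.Base using (_∘_)
open import Function.Bundles using (_↔_; Inverse; mk⇔)
open import Relation.Nullary using (¬_)
open import Relation.Binary.PropositionalEquality

module _ {d : ℕ} .{{_ : NonZero d}} where

  0%d≡0 : 0 % d ≡ 0
  0%d≡0 = m<n⇒m%n≡m (>-nonZero⁻¹ d)

  [m+n%d]%d≡[m+n]%d : ∀ a b → (a + b % d) % d ≡ (a + b) % d
  [m+n%d]%d≡[m+n]%d a b = begin
    (a + b % d) % d           ≡⟨ %-distribˡ-+ a (b % d) d ⟩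
    (a % d + b % d % d) % d   ≡⟨ cong (λ t → (a % d + t) % d) (m%n%n≡m%n b d) ⟩
    (a % d + b % d) % d       ≡⟨ %-distribˡ-+ a b d ⟨
    (a + b) % d               ∎
    where open ≡-Reasoning

  [m*[n%d]]%d≡[m*n]%d : ∀ a b → (a * (b % d)) % d ≡ (a * b) % d
  [m*[n%d]]%d≡[m*n]%d a b = begin
    (a * (b % d)) % d           ≡⟨ %-distribˡ-* a (b % d) d ⟩
    (a % d * (b % d % d)) % d   ≡⟨ cong (λ t → (a % d * t) % d) (m%n%n≡m%n b d) ⟩
    (a % d * (b % d)) % d       ≡⟨ %-distribˡ-* a b d ⟨
    (a * b) % d                 ∎
    where open ≡-Reasoning

  [m+n]%d≡n⇒d∣m : ∀ a b → (a + b) % d ≡ b → d ∣ a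
  [m+n]%d≡n⇒d∣m a b eq = divides k (+-cancelʳ-≡ b a (k * d) (begin
    a + b             ≡⟨ m≡m%n+[m/n]*n (a + b) d ⟩
    (a + b) % d + k * d ≡⟨ cong (_+ k * d) eq ⟩
    b + k * d         ≡⟨ +-comm b (k * d) ⟩
    k * d + b         ∎))
    where
    k = (a + b) / d
    open ≡-Reasoning

  d∣n∸1⇒n%d≡1%d : ∀ {a} → 1 ≤ a → d ∣ a ∸ 1 → a % d ≡ 1 % d
  d∣n∸1⇒n%d≡1%d {suc a} _ (divides k a≡k*d) =
    trans (cong (λ t → suc t % d) a≡k*d) ([m+kn]%n≡m%n 1 k d)

  n%d≡1%d⇒n^t%d≡1%d : ∀ {a} t → a % d ≡ 1 % d → (a ^ t) % d ≡ 1 % d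
  n%d≡1%d⇒n^t%d≡1%d zero    _  = refl
  n%d≡1%d⇒n^t%d≡1%d {a} (suc t) a≡1 = begin
    (a * a ^ t) % d               ≡⟨ %-distribˡ-* a (a ^ t) d ⟩
    (a % d * ((a ^ t) % d)) % d   ≡⟨ cong₂ (λ u v → (u * v) % d) a≡1 (n%d≡1%d⇒n^t%d≡1%d t a≡1) ⟩
    (1 % d * (1 % d)) % d         ≡⟨ %-distribˡ-* 1 1 d ⟨
    1 % d                         ∎
    where open ≡-Reasoning

  m%d≡1%d⇒[m*n]%d≡n%d : ∀ {a} b → a % d ≡ 1 % d → (a * b) % d ≡ b % d
  m%d≡1%d⇒[m*n]%d≡n%d {a} b a≡1 = begin
    (a * b) % d               ≡⟨ %-distribˡ-* a b d ⟩
    (a % d * (b % d)) % d     ≡⟨ cong (λ u → (u * (b % d)) % d) a≡1 ⟩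
    (1 % d * (b % d)) % d     ≡⟨ %-distribˡ-* 1 b d ⟨
    (1 * b) % d               ≡⟨ cong (_% d) (*-identityˡ b) ⟩
    b % d                     ∎
    where open ≡-Reasoning

  d∣aᵉ∸1∧e∣h⇒aʰ%d≡1%d : ∀ {a e h} → 1 ≤ a → d ∣ a ^ e ∸ 1 → e ∣ h → (a ^ h) % d ≡ 1 % d
  d∣aᵉ∸1∧e∣h⇒aʰ%d≡1%d {a} {e} {h} 1≤a d∣aᵉ∸1 (divides t h≡t*e) = begin
    (a ^ h) % d           ≡⟨ cong (λ x → (a ^ x) % d) (trans h≡t*e (*-comm t e)) ⟩
    (a ^ (e * t)) % d     ≡⟨ cong (_% d) (^-*-assoc a e t) ⟨
    ((a ^ e) ^ t) % d     ≡⟨ n%d≡1%d⇒n^t%d≡1%d t (d∣n∸1⇒n%d≡1%d 1≤aᵉ d∣aᵉ∸1) ⟩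
    1 % d                 ∎
    where
    open ≡-Reasoning
    1≤aᵉ : 1 ≤ a ^ e
    1≤aᵉ = m^n>0 a {{>-nonZero 1≤a}} e

data TwoOrThree : ℕ → Set where
  two   : TwoOrThree 2
  three : TwoOrThree 3

2≤twoOrThree : ∀ {p} → TwoOrThree p → 2 ≤ p
2≤twoOrThree two   = ≤-refl
2≤twoOrThree three = n≤1+n 2

p*h∣p*x⇒x≡h⊎x≡p*h∸h : ∀ {p h x} → TwoOrThree p → x < p * h → p * h ∣ p * x → x ≢ 0 →
                      x ≡ h ⊎ x ≡ p * h ∸ h
p*h∣p*x⇒x≡h⊎x≡p*h∸h {p} {h} {x} p∈ x<ph ph∣px x≢0 =
  by-quotient p∈ q x≡qh (*-cancelʳ-< h q p (subst (_< p * h) x≡qh x<ph))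
  where
  instance
    p≢0 : NonZero p
    p≢0 = >-nonZero (≤-trans (s≤s z≤n) (2≤twoOrThree p∈))
  open _∣_ (*-cancelˡ-∣ p ph∣px) renaming (quotient to q; equality to x≡qh)
  by-quotient : ∀ {p} → TwoOrThree p → ∀ q → x ≡ q * h → q < p → x ≡ h ⊎ x ≡ p * h ∸ h
  by-quotient _     0                   x≡0  _ = ⊥-elim (x≢0 x≡0)
  by-quotient _     1                   x≡h  _ = inj₁ (trans x≡h (+-identityʳ h))
  by-quotient three 2                   x≡2h _ = inj₂ (trans x≡2h (sym (m+n∸m≡n h (2 * h))))
  by-quotient two   (suc (suc _))       _    (s≤s (s≤s ()))
  by-quotient three (suc (suc (suc _))) _    (s≤s (s≤s (s≤s ())))

^-monoʳ-∣ : ∀ a {m n} → m ≤ n → a ^ m ∣ a ^ n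
^-monoʳ-∣ a {n = n} z≤n = 1∣ (a ^ n)
^-monoʳ-∣ a (s≤s m≤n)   = *-monoʳ-∣ a (^-monoʳ-∣ a m≤n)

coprime-∣ : ∀ {a b a′ b′} → a′ ∣ a → b′ ∣ b → Coprime a b → Coprime a′ b′
coprime-∣ a′∣a b′∣b a⊥b (d∣a′ , d∣b′) = a⊥b (∣-trans d∣a′ a′∣a , ∣-trans d∣b′ b′∣b)

zOrder-suc-r : ∀ r s → zOrder (suc r) s ≡ 2 * zOrder r s
zOrder-suc-r r s = *-assoc 2 (2 ^ r) (3 ^ s)

zOrder-suc-s : ∀ r s → zOrder r (suc s) ≡ 3 * zOrder r s
zOrder-suc-s r s = begin
  2 ^ r * (3 * 3 ^ s)   ≡⟨ *-assoc (2 ^ r) 3 (3 ^ s) ⟨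
  2 ^ r * 3 * 3 ^ s     ≡⟨ cong (_* 3 ^ s) (*-comm (2 ^ r) 3) ⟩
  3 * 2 ^ r * 3 ^ s     ≡⟨ *-assoc 3 (2 ^ r) (3 ^ s) ⟩
  3 * (2 ^ r * 3 ^ s)   ∎
  where open ≡-Reasoning

zOrder-∣ : ∀ {r₀ s₀ r s} → r₀ ≤ r → s₀ ≤ s → zOrder r₀ s₀ ∣ zOrder r s
zOrder-∣ r₀≤r s₀≤s = *-pres-∣ (^-monoʳ-∣ 2 r₀≤r) (^-monoʳ-∣ 3 s₀≤s)

zOrder-split : ∀ {r₀ s₀ r s} → r₀ ≤ r → s₀ ≤ s →
               zOrder r s ≡ zOrder r₀ s₀
               ⊎ ∃₂ λ p h → TwoOrThree p × zOrder r s ≡ p * h × zOrder r₀ s₀ ∣ h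
zOrder-split {r₀} {s₀} {r} {s} r₀≤r s₀≤s with m≤n⇒m<n∨m≡n r₀≤r | m≤n⇒m<n∨m≡n s₀≤s
... | inj₁ (s≤s {n = r′} r₀≤r′) | _ =
  inj₂ (2 , zOrder r′ s , two , zOrder-suc-r r′ s , zOrder-∣ r₀≤r′ s₀≤s)
... | inj₂ refl | inj₁ (s≤s {n = s′} s₀≤s′) =
  inj₂ (3 , zOrder r s′ , three , zOrder-suc-s r s′ , zOrder-∣ (≤-refl {r}) s₀≤s′)
... | inj₂ refl | inj₂ refl = inj₁ refl

OfType : (e r s m : ℕ) → Set
OfType e r s m =
    (e ≡ 2 × 1 ≤ r × s ≡ 0 × ¬ (2 ∣ m))
  ⊎ (e ≡ 3 × r ≡ 0 × 1 ≤ s × ¬ (3 ∣ m))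
  ⊎ (e ≡ 4 × 2 ≤ r × s ≡ 0 × ¬ (2 ∣ m))
  ⊎ (e ≡ 6 × 1 ≤ r × 1 ≤ s × gcd m 6 ≡ 1)

ofType⇒e≡zOrder : ∀ {e r s m} → OfType e r s m → ∃₂ λ r₀ s₀ → r₀ ≤ r × s₀ ≤ s × e ≡ zOrder r₀ s₀
ofType⇒e≡zOrder (inj₁ (refl , 1≤r , refl , _))                = 1 , 0 , 1≤r , z≤n , refl
ofType⇒e≡zOrder (inj₂ (inj₁ (refl , refl , 1≤s , _)))         = 0 , 1 , z≤n , 1≤s , refl
ofType⇒e≡zOrder (inj₂ (inj₂ (inj₁ (refl , 2≤r , refl , _))))  = 2 , 0 , 2≤r , z≤n , refl
ofType⇒e≡zOrder (inj₂ (inj₂ (inj₂ (refl , 1≤r , 1≤s , _))))   = 1 , 1 , 1≤r , 1≤s , refl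

module _ {q : ℕ} .{{_ : NonZero q}} where

  toℕ-mod : ∀ a → toℕ (a mod q) ≡ a % q
  toℕ-mod a = toℕ-fromℕ< (m%n<n a q)

  mod-cong : ∀ {a b} → a % q ≡ b % q → a mod q ≡ b mod q
  mod-cong {a} {b} eq = toℕ-injective (trans (toℕ-mod a) (trans eq (sym (toℕ-mod b))))

  toℕ-mod-< : ∀ {a} → a < q → toℕ (a mod q) ≡ a
  toℕ-mod-< {a} a<q = trans (toℕ-mod a) (m<n⇒m%n≡m a<q)

  mod-toℕ : ∀ (x : Fin q) → toℕ x mod q ≡ x
  mod-toℕ x = toℕ-injective (toℕ-mod-< (toℕ<n x))

  toℕ-zeroZ : toℕ (zeroZ {q}) ≡ 0
  toℕ-zeroZ = trans (toℕ-mod 0) 0%d≡0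

  toℕ≡0⇒≡zeroZ : ∀ {x : Fin q} → toℕ x ≡ 0 → x ≡ zeroZ
  toℕ≡0⇒≡zeroZ x≡0 = toℕ-injective (trans x≡0 (sym toℕ-zeroZ))

  addZ-identityˡ : ∀ (x : Fin q) → addZ zeroZ x ≡ x
  addZ-identityˡ x = trans (cong (λ t → (t + toℕ x) mod q) toℕ-zeroZ) (mod-toℕ x)

  addZ-identityʳ : ∀ (x : Fin q) → addZ x zeroZ ≡ x
  addZ-identityʳ x = trans (cong (_mod q) (trans (cong (toℕ x +_) toℕ-zeroZ) (+-identityʳ (toℕ x))))
                           (mod-toℕ x)

  addZ-comm : ∀ (x y : Fin q) → addZ x y ≡ addZ y x
  addZ-comm x y = cong (_mod q) (+-comm (toℕ x) (toℕ y))

  smulZ-zeroʳ : ∀ c → smulZ c (zeroZ {q}) ≡ zeroZ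
  smulZ-zeroʳ c = mod-cong (cong (_% q) (trans (cong (c *_) toℕ-zeroZ) (*-zeroʳ c)))

  smulZ-identity : ∀ {a} → a % q ≡ 1 % q → ∀ (x : Fin q) → smulZ a x ≡ x
  smulZ-identity {a} a≡1 x = toℕ-injective (begin
    toℕ ((a * toℕ x) mod q)   ≡⟨ toℕ-mod _ ⟩
    (a * toℕ x) % q           ≡⟨ m%d≡1%d⇒[m*n]%d≡n%d (toℕ x) a≡1 ⟩
    toℕ x % q                 ≡⟨ m<n⇒m%n≡m (toℕ<n x) ⟩
    toℕ x                     ∎)
    where open ≡-Reasoning

  smulZ-suc-fixed⇒zero : ∀ {d} → Coprime q d → ∀ (x : Fin q) → smulZ (suc d) x ≡ x → x ≡ zeroZ
  smulZ-suc-fixed⇒zero {d} q⊥d x fixed = toℕ≡0⇒≡zeroZ x≡0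
    where
    [dx+x]%q≡x : (d * toℕ x + toℕ x) % q ≡ toℕ x
    [dx+x]%q≡x = trans (cong (_% q) (+-comm (d * toℕ x) (toℕ x)))
                       (trans (sym (toℕ-mod _)) (cong toℕ fixed))
    q∣x : q ∣ toℕ x
    q∣x = coprime-divisor q⊥d ([m+n]%d≡n⇒d∣m (d * toℕ x) (toℕ x) [dx+x]%q≡x)
    x≡0 : toℕ x ≡ 0
    x≡0 = trans (sym (m<n⇒m%n≡m (toℕ<n x))) (n∣m⇒m%n≡0 (toℕ x) q q∣x)

  negZ-zero : negZ (zeroZ {q}) ≡ zeroZ
  negZ-zero = mod-cong (trans (cong (λ t → (q ∸ t) % q) toℕ-zeroZ) (trans (n%n≡0 q) (sym 0%d≡0)))

  toℕ-negZ : ∀ {x : Fin q} → 0 < toℕ x → toℕ (negZ x) ≡ q ∸ toℕ x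
  toℕ-negZ {x} 0<x = toℕ-mod-< (∸-monoʳ-< 0<x (<⇒≤ (toℕ<n x)))

  negZ-involutive : ∀ (x : Fin q) → negZ (negZ x) ≡ x
  negZ-involutive x with m≤n⇒m<n∨m≡n (z≤n {toℕ x})
  ... | inj₂ 0≡x = begin
    negZ (negZ x)  ≡⟨ cong negZ (trans (cong negZ x≡zeroZ) negZ-zero) ⟩
    negZ zeroZ     ≡⟨ negZ-zero ⟩
    zeroZ          ≡⟨ x≡zeroZ ⟨
    x              ∎
    where
    open ≡-Reasoning
    x≡zeroZ = toℕ≡0⇒≡zeroZ (sym 0≡x)
  ... | inj₁ 0<x = toℕ-injective (begin
    toℕ (negZ (negZ x))   ≡⟨ toℕ-negZ 0<−x ⟩
    q ∸ toℕ (negZ x)      ≡⟨ cong (q ∸_) (toℕ-negZ 0<x) ⟩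
    q ∸ (q ∸ toℕ x)       ≡⟨ m∸[m∸n]≡n (<⇒≤ (toℕ<n x)) ⟩
    toℕ x                 ∎)
    where
    open ≡-Reasoning
    0<−x : 0 < toℕ (negZ x)
    0<−x = subst (0 <_) (sym (toℕ-negZ 0<x)) (m<n⇒0<n∸m (toℕ<n x))

_≡1-mod_ : ℕ → PrimePower → Set
a ≡1-mod c = a % modulus c ≡ 1 % modulus c
  where instance _ = modulus-nonZero c

addM-identityˡ : ∀ {cs} (x : Elt cs) → addM zeroM x ≡ x
addM-identityˡ {[]}     _        = refl
addM-identityˡ {c ∷ cs} (x , xs) =
  cong₂ _,_ (addZ-identityˡ {{modulus-nonZero c}} x) (addM-identityˡ xs)

addM-identityʳ : ∀ {cs} (x : Elt cs) → addM x zeroM ≡ x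
addM-identityʳ {[]}     _        = refl
addM-identityʳ {c ∷ cs} (x , xs) =
  cong₂ _,_ (addZ-identityʳ {{modulus-nonZero c}} x) (addM-identityʳ xs)

smulM-zeroʳ : ∀ {cs} a → smulM {cs} a zeroM ≡ zeroM
smulM-zeroʳ {[]}     _ = refl
smulM-zeroʳ {c ∷ cs} a = cong₂ _,_ (smulZ-zeroʳ {{modulus-nonZero c}} a) (smulM-zeroʳ a)

negM-zero : ∀ {cs} → negM {cs} zeroM ≡ zeroM
negM-zero {[]}     = refl
negM-zero {c ∷ cs} = cong₂ _,_ (negZ-zero {{modulus-nonZero c}}) negM-zero

smulM-identity : ∀ {cs a} → All (a ≡1-mod_) cs →
                 ∀ (x : Elt cs) → smulM a x ≡ x
smulM-identity {[]}     []           _        = refl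
smulM-identity {c ∷ cs} (a≡1 ∷ a≡1s) (x , xs) =
  cong₂ _,_ (smulZ-identity {{modulus-nonZero c}} a≡1 x) (smulM-identity a≡1s xs)

smulM-identityˡ : ∀ {cs} (x : Elt cs) → smulM 1 x ≡ x
smulM-identityˡ {cs} = smulM-identity (All.universal (λ _ → refl) cs)

smulM-suc-fixed⇒zero : ∀ {cs d} → All (λ c → Coprime (modulus c) d) cs →
                       ∀ (x : Elt cs) → smulM (suc d) x ≡ x → x ≡ zeroM
smulM-suc-fixed⇒zero {[]}     []           _        _     = refl
smulM-suc-fixed⇒zero {c ∷ cs} (q⊥d ∷ q⊥ds) (x , xs) fixed = cong₂ _,_
  (smulZ-suc-fixed⇒zero {{modulus-nonZero c}} q⊥d x (cong proj₁ fixed))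
  (smulM-suc-fixed⇒zero q⊥ds xs (cong proj₂ fixed))

annihilator⇒modulus∣ : ∀ {cs m} → (∀ (x : Elt cs) → smulM m x ≡ zeroM) → All (λ c → modulus c ∣ m) cs
annihilator⇒modulus∣ {[]}     _      = []
annihilator⇒modulus∣ {c ∷ cs} {m} m·≡0 =
  q∣m ∷ annihilator⇒modulus∣ (λ x → cong proj₂ (m·≡0 (zeroZ , x)))
  where
  instance _ = modulus-nonZero c
  q = modulus c
  m%q≡0 : m % q ≡ 0
  m%q≡0 = begin
    m % q                         ≡⟨ cong (_% q) (*-identityʳ m) ⟨
    (m * 1) % q                   ≡⟨ [m*[n%d]]%d≡[m*n]%d m 1 ⟨
    (m * (1 % q)) % q             ≡⟨ cong (λ t → (m * t) % q) (toℕ-mod 1) ⟨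
    (m * toℕ (1 mod q)) % q       ≡⟨ toℕ-mod _ ⟨
    toℕ (smulZ m (1 mod q))       ≡⟨ cong (toℕ ∘ proj₁) (m·≡0 (1 mod q , zeroM)) ⟩
    toℕ (zeroZ {q})               ≡⟨ toℕ-zeroZ ⟩
    0                             ∎
    where open ≡-Reasoning
  q∣m : q ∣ m
  q∣m = m%n≡0⇒n∣m m q m%q≡0

module _ (G : GroupOps) where
  open GroupOps G

  Central : Carrier → Set
  Central c = ∀ g → c ∙ g ≡ g ∙ c

  FixedUpToInverse : Carrier → Set
  FixedUpToInverse c = ∀ α → IsAut G α → Inverse.to α c ≡ c ⊎ Inverse.to α c ≡ c ⁻¹

  module _ (α : Carrier ↔ Carrier) (α-hom : IsAut G α) where
    open Inverse α

    aut-ε : (∀ g → ε ∙ g ≡ g) → (∀ g → g ∙ ε ≡ g) → to ε ≡ ε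
    aut-ε identityˡ identityʳ = begin
      to ε                ≡⟨ identityʳ (to ε) ⟨
      to ε ∙ ε            ≡⟨ cong (to ε ∙_) (strictlyInverseˡ ε) ⟨
      to ε ∙ to (from ε)  ≡⟨ α-hom ε (from ε) ⟨
      to (ε ∙ from ε)     ≡⟨ cong to (identityˡ (from ε)) ⟩
      to (from ε)         ≡⟨ strictlyInverseˡ ε ⟩
      ε                   ∎
      where open ≡-Reasoning

    aut-≢ε : to ε ≡ ε → ∀ {c} → c ≢ ε → to c ≢ ε
    aut-≢ε αε≡ε {c} c≢ε αc≡ε = c≢ε (begin
      c               ≡⟨ strictlyInverseʳ c ⟨
      from (to c)     ≡⟨ cong from (trans αc≡ε (sym αε≡ε)) ⟩
      from (to ε)     ≡⟨ strictlyInverseʳ ε ⟩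
      ε               ∎)
      where open ≡-Reasoning

    aut-pow : to ε ≡ ε → ∀ g d → to (pow G g d) ≡ pow G (to g) d
    aut-pow αε≡ε g zero    = αε≡ε
    aut-pow αε≡ε g (suc d) = trans (α-hom g (pow G g d)) (cong (to g ∙_) (aut-pow αε≡ε g d))

    aut-central : ∀ {c} → Central c → Central (to c)
    aut-central {c} c-central g = begin
      to c ∙ g                ≡⟨ cong (to c ∙_) (strictlyInverseˡ g) ⟨
      to c ∙ to (from g)      ≡⟨ α-hom c (from g) ⟨
      to (c ∙ from g)         ≡⟨ cong to (c-central (from g)) ⟩
      to (from g ∙ c)         ≡⟨ α-hom (from g) c ⟩
      to (from g) ∙ to c      ≡⟨ cong (_∙ to c) (strictlyInverseˡ g) ⟩
      g ∙ to c                ∎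
      where open ≡-Reasoning

  inverseClosed-⁻¹ : ∀ {S c} → InverseClosed G S → c ⁻¹ ⁻¹ ≡ c → S (c ⁻¹) ≡ S c
  inverseClosed-⁻¹ {S} {c} S-inv c⁻¹⁻¹≡c = ⇔→≡ (mk⇔
    (λ Sc⁻¹ → subst (λ g → S g ≡ true) c⁻¹⁻¹≡c (S-inv (c ⁻¹) Sc⁻¹))
    (S-inv c))

  CI∧kIf⇒¬FixedUpToInverse : ∀ {k c} → IsCIGroup G → 2 ≤ k → HasKIfProperty G k →
                               c ≢ ε → c ⁻¹ ⁻¹ ≡ c → ¬ FixedUpToInverse c
  CI∧kIf⇒¬FixedUpToInverse {c = c} isCI (s≤s (s≤s _))
    (S , P , (i₀ , P≗S) , (P-ε , _ , disjoint , cover) , P-inv , P≅S) c≢ε c⁻¹⁻¹≡c fixed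
    with cover c c≢ε
  ... | j , Pjc = 0≢1+n (disjoint zero (suc zero) c (c∈P zero) (c∈P (suc zero)))
    where
    S-conn : ConnSet G S
    S-conn = trans (sym (P≗S ε)) (P-ε i₀)
           , λ g Sg → trans (sym (P≗S (g ⁻¹))) (P-inv i₀ g (trans (P≗S g) Sg))
    block≡S : ∀ i → P i c ≡ S c
    block≡S i with isCI (P i) S (P-ε i , P-inv i) S-conn (P≅S i)
    ... | α , α-hom , S∘α≗P with fixed α α-hom
    ...   | inj₁ αc≡c   = trans (sym (S∘α≗P c)) (cong S αc≡c)
    ...   | inj₂ αc≡c⁻¹ = trans (sym (S∘α≗P c))
                            (trans (cong S αc≡c⁻¹) (inverseClosed-⁻¹ (proj₂ S-conn) c⁻¹⁻¹≡c))
    c∈P : ∀ i → P i c ≡ true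
    c∈P i = trans (block≡S i) (trans (sym (block≡S j)) Pjc)

module HProperties (cs : List PrimePower) (r s l : ℕ) where
  open GroupOps (H cs r s l)

  private
    n = zOrder r s
    instance _ = zOrder-nonZero r s

  zPow : Fin n → Carrier
  zPow i = i , zeroM

  identityˡ : ∀ g → ε ∙ g ≡ g
  identityˡ (j , y) = cong₂ _,_ (addZ-identityˡ j)
    (trans (cong (λ t → addM t y) (smulM-zeroʳ _)) (addM-identityˡ y))

  identityʳ : ∀ g → g ∙ ε ≡ g
  identityʳ (j , y) = cong₂ _,_ (addZ-identityʳ j)
    (trans (addM-identityʳ _) (trans (cong (λ t → smulM (l ^ t) y) toℕ-zeroZ) (smulM-identityˡ y)))

  pow-zPow : ∀ i d → pow (H cs r s l) (zPow i) d ≡ zPow ((d * toℕ i) mod n)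
  pow-zPow i zero    = refl
  pow-zPow i (suc d) = begin
    zPow i ∙ pow (H cs r s l) (zPow i) d   ≡⟨ cong (zPow i ∙_) (pow-zPow i d) ⟩
    zPow i ∙ zPow ((d * toℕ i) mod n)       ≡⟨ cong₂ _,_ i+di≡[1+d]i
                                                   (trans (addM-identityʳ _) (smulM-zeroʳ _)) ⟩
    zPow ((suc d * toℕ i) mod n)            ∎
    where
    open ≡-Reasoning
    i+di≡[1+d]i : addZ i ((d * toℕ i) mod n) ≡ (suc d * toℕ i) mod n
    i+di≡[1+d]i = mod-cong (trans (cong (λ t → (toℕ i + t) % n) (toℕ-mod (d * toℕ i)))
                                  ([m+n%d]%d≡[m+n]%d (toℕ i) (d * toℕ i)))

  zPow-⁻¹ : ∀ i → zPow i ⁻¹ ≡ zPow (negZ i)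
  zPow-⁻¹ i = cong (negZ i ,_) (trans (cong negM (smulM-zeroʳ _)) negM-zero)

  zPow-⁻¹-involutive : ∀ i → zPow i ⁻¹ ⁻¹ ≡ zPow i
  zPow-⁻¹-involutive i = begin
    zPow i ⁻¹ ⁻¹            ≡⟨ cong _⁻¹ (zPow-⁻¹ i) ⟩
    zPow (negZ i) ⁻¹        ≡⟨ zPow-⁻¹ (negZ i) ⟩
    zPow (negZ (negZ i))    ≡⟨ cong zPow (negZ-involutive i) ⟩
    zPow i                  ∎
    where open ≡-Reasoning

  zPow-≢ε : ∀ {i} → toℕ i ≢ 0 → zPow i ≢ ε
  zPow-≢ε i≢0 zPowi≡ε = i≢0 (trans (cong (toℕ ∘ proj₁) zPowi≡ε) toℕ-zeroZ)

  zPow-central : ∀ {i} → (∀ (y : Elt cs) → smulM (l ^ toℕ i) y ≡ y) → Central (H cs r s l) (zPow i)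
  zPow-central {i} lⁱ-trivial (j , y) = cong₂ _,_ (addZ-comm i j) (begin
    addM (smulM (l ^ toℕ j) zeroM) y   ≡⟨ cong (λ t → addM t y) (smulM-zeroʳ _) ⟩
    addM zeroM y                       ≡⟨ addM-identityˡ y ⟩
    y                                  ≡⟨ lⁱ-trivial y ⟨
    smulM (l ^ toℕ i) y                ≡⟨ addM-identityʳ _ ⟨
    addM (smulM (l ^ toℕ i) y) zeroM   ∎)
    where open ≡-Reasoning

  commutes-with-zGen⇒zPow : 1 < n → 1 ≤ l → All (λ c → Coprime (modulus c) (l ∸ 1)) cs →
                            ∀ g → g ∙ zGen cs r s l ≡ zGen cs r s l ∙ g → g ≡ zPow (proj₁ g)
  commutes-with-zGen⇒zPow 1<n 1≤l coprime (i , x) commutes =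
    cong (i ,_) (smulM-suc-fixed⇒zero coprime x lx≡x)
    where
    l¹≡1+[l∸1] : l ^ toℕ (1 mod n) ≡ suc (l ∸ 1)
    l¹≡1+[l∸1] = trans (cong (l ^_) (toℕ-mod-< 1<n))
                       (trans (*-identityʳ l) (sym (m+[n∸m]≡n 1≤l)))
    lx≡x : smulM (suc (l ∸ 1)) x ≡ x
    lx≡x = begin
      smulM (suc (l ∸ 1)) x                             ≡⟨ cong (λ t → smulM t x) l¹≡1+[l∸1] ⟨
      smulM (l ^ toℕ (1 mod n)) x                       ≡⟨ addM-identityʳ _ ⟨
      addM (smulM (l ^ toℕ (1 mod n)) x) zeroM          ≡⟨ cong proj₂ commutes ⟩
      addM (smulM (l ^ toℕ i) zeroM) x                  ≡⟨ cong (λ t → addM t x) (smulM-zeroʳ _) ⟩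
      addM zeroM x                                      ≡⟨ addM-identityˡ x ⟩
      x                                                 ∎
      where open ≡-Reasoning

  pow-zGen : ∀ d → pow (H cs r s l) (zGen cs r s l) d ≡ zPow (d mod n)
  pow-zGen d = trans (pow-zPow (1 mod n) d) (cong zPow (mod-cong (begin
    (d * toℕ (1 mod n)) % n   ≡⟨ cong (λ t → (d * t) % n) (toℕ-mod 1) ⟩
    (d * (1 % n)) % n         ≡⟨ [m*[n%d]]%d≡[m*n]%d d 1 ⟩
    (d * 1) % n               ≡⟨ cong (_% n) (*-identityʳ d) ⟩
    d % n                     ∎)))
    where open ≡-Reasoning

  zGen-hasOrder : HasOrder (H cs r s l) (zGen cs r s l) n
  zGen-hasOrder = >-nonZero⁻¹ n , zGenⁿ≡ε , minimal
    where
    zGenⁿ≡ε : pow (H cs r s l) (zGen cs r s l) n ≡ ε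
    zGenⁿ≡ε = trans (pow-zGen n) (cong zPow (mod-cong (trans (n%n≡0 n) (sym 0%d≡0))))
    minimal : ∀ d → 1 ≤ d → pow (H cs r s l) (zGen cs r s l) d ≡ ε → n ≤ d
    minimal d 1≤d zGenᵈ≡ε = ∣⇒≤ {{>-nonZero 1≤d}} (m%n≡0⇒n∣m d n (begin
      d % n                 ≡⟨ toℕ-mod d ⟨
      toℕ (d mod n)         ≡⟨ cong (toℕ ∘ proj₁) (trans (sym (pow-zGen d)) zGenᵈ≡ε) ⟩
      toℕ (zeroZ {n})       ≡⟨ toℕ-zeroZ ⟩
      0                     ∎))
      where open ≡-Reasoning

  module Zʰ (1≤l : 1 ≤ l) (coprime : All (λ c → Coprime (modulus c) (l ∸ 1)) cs)
           {p h : ℕ} (p∈ : TwoOrThree p) (n≡p*h : n ≡ p * h)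
           (lʰ-trivial : ∀ (y : Elt cs) → smulM (l ^ h) y ≡ y) where

    private
      0<h : 0 < h
      0<h = n≢0⇒n>0 (λ h≡0 → ≢-nonZero⁻¹ n (trans n≡p*h (trans (cong (p *_) h≡0) (*-zeroʳ p))))

      h<n : h < n
      h<n = subst (h <_) (sym n≡p*h)
              (subst (_< p * h) (*-identityˡ h) (*-monoˡ-< h {{>-nonZero 0<h}} (2≤twoOrThree p∈)))

      1<n : 1 < n
      1<n = ≤-<-trans 0<h h<n

    zʰ : Carrier
    zʰ = zPow (h mod n)

    toℕ-zʰ : toℕ (h mod n) ≡ h
    toℕ-zʰ = toℕ-mod-< h<n

    zʰ-≢ε : zʰ ≢ ε
    zʰ-≢ε = zPow-≢ε (subst (_≢ 0) (sym toℕ-zʰ) (≢-nonZero⁻¹ h {{>-nonZero 0<h}}))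

    zʰ-central : Central (H cs r s l) zʰ
    zʰ-central =
      zPow-central (subst (λ t → ∀ (y : Elt cs) → smulM (l ^ t) y ≡ y) (sym toℕ-zʰ) lʰ-trivial)

    zʰ^p≡ε : pow (H cs r s l) zʰ p ≡ ε
    zʰ^p≡ε = trans (pow-zPow (h mod n) p) (cong zPow (mod-cong (begin
      (p * toℕ (h mod n)) % n   ≡⟨ cong (λ t → (p * t) % n) toℕ-zʰ ⟩
      (p * h) % n               ≡⟨ cong (_% n) n≡p*h ⟨
      n % n                     ≡⟨ n%n≡0 n ⟩
      0                         ≡⟨ 0%d≡0 ⟨
      0 % n                     ∎)))
      where open ≡-Reasoning

    module _ (α : Carrier ↔ Carrier) (α-hom : IsAut (H cs r s l) α) where
      open Inverse α

      private
        αε≡ε : to ε ≡ ε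
        αε≡ε = aut-ε (H cs r s l) α α-hom identityˡ identityʳ

        i : Fin n
        i = proj₁ (to zʰ)

      aut-zʰ≡zPow : to zʰ ≡ zPow i
      aut-zʰ≡zPow = commutes-with-zGen⇒zPow 1<n 1≤l coprime (to zʰ)
                      (aut-central (H cs r s l) α α-hom zʰ-central (zGen cs r s l))

      aut-zʰ-≢0 : toℕ i ≢ 0
      aut-zʰ-≢0 i≡0 = aut-≢ε (H cs r s l) α α-hom αε≡ε zʰ-≢ε
                        (trans aut-zʰ≡zPow (cong zPow (toℕ≡0⇒≡zeroZ i≡0)))

      aut-zʰ-order : p * h ∣ p * toℕ i
      aut-zʰ-order = subst (_∣ p * toℕ i) n≡p*h (m%n≡0⇒n∣m (p * toℕ i) n (begin
        (p * toℕ i) % n                         ≡⟨ toℕ-mod _ ⟨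
        toℕ ((p * toℕ i) mod n)                 ≡⟨ cong (toℕ ∘ proj₁) zPowᵢ^p≡ε ⟩
        toℕ (zeroZ {n})                         ≡⟨ toℕ-zeroZ ⟩
        0                                       ∎))
        where
        open ≡-Reasoning
        zPowᵢ^p≡ε : zPow ((p * toℕ i) mod n) ≡ ε
        zPowᵢ^p≡ε = begin
          zPow ((p * toℕ i) mod n)        ≡⟨ pow-zPow i p ⟨
          pow (H cs r s l) (zPow i) p     ≡⟨ cong (λ g → pow (H cs r s l) g p) aut-zʰ≡zPow ⟨
          pow (H cs r s l) (to zʰ) p      ≡⟨ aut-pow (H cs r s l) α α-hom αε≡ε zʰ p ⟨
          to (pow (H cs r s l) zʰ p)      ≡⟨ cong to zʰ^p≡ε ⟩
          to ε                            ≡⟨ αε≡ε ⟩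
          ε                               ∎

    zʰ-fixedUpToInverse : FixedUpToInverse (H cs r s l) zʰ
    zʰ-fixedUpToInverse α α-hom =
      Sum.map aut-zʰ≡zʰ aut-zʰ≡zʰ⁻¹
        (p*h∣p*x⇒x≡h⊎x≡p*h∸h p∈ (subst (toℕ i <_) n≡p*h (toℕ<n i))
                              (aut-zʰ-order α α-hom) (aut-zʰ-≢0 α α-hom))
      where
      open Inverse α
      i = proj₁ (to zʰ)
      aut-zʰ≡zʰ : toℕ i ≡ h → to zʰ ≡ zʰ
      aut-zʰ≡zʰ i≡h = trans (aut-zʰ≡zPow α α-hom) (cong zPow (toℕ-injective (trans i≡h (sym toℕ-zʰ))))
      aut-zʰ≡zʰ⁻¹ : toℕ i ≡ p * h ∸ h → to zʰ ≡ zʰ ⁻¹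
      aut-zʰ≡zʰ⁻¹ i≡n∸h = begin
        to zʰ                  ≡⟨ aut-zʰ≡zPow α α-hom ⟩
        zPow i                 ≡⟨ cong zPow (toℕ-injective i≡−h) ⟩
        zPow (negZ (h mod n))  ≡⟨ zPow-⁻¹ (h mod n) ⟨
        zʰ ⁻¹                  ∎
        where
        open ≡-Reasoning
        i≡−h : toℕ i ≡ toℕ (negZ (h mod n))
        i≡−h = begin
          toℕ i                    ≡⟨ i≡n∸h ⟩
          p * h ∸ h                ≡⟨ cong₂ _∸_ n≡p*h toℕ-zʰ ⟨
          n ∸ toℕ (h mod n)        ≡⟨ toℕ-negZ (subst (0 <_) (sym toℕ-zʰ) 0<h) ⟨
          toℕ (negZ (h mod n))     ∎

lemma4p8 : (k : ℕ) → 2 ≤ k →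
    (cs : List PrimePower) → Homocyclic cs →
    (m : ℕ) → IsExponent cs m →
    (l : ℕ) → 1 ≤ l → l ≤ m → gcd (l * (l ∸ 1)) m ≡ 1 →
    (e : ℕ) → IsMultOrder l m e →
    (r s : ℕ) →
    (  (e ≡ 2 × 1 ≤ r × s ≡ 0 × ¬ (2 ∣ m))
     ⊎ (e ≡ 3 × r ≡ 0 × 1 ≤ s × ¬ (3 ∣ m))
     ⊎ (e ≡ 4 × 2 ≤ r × s ≡ 0 × ¬ (2 ∣ m))
     ⊎ (e ≡ 6 × 1 ≤ r × 1 ≤ s × gcd m 6 ≡ 1)) →
    IsCIGroup (H cs r s l) →
    HasKIfProperty (H cs r s l) k →
    HasOrder (H cs r s l) (zGen cs r s l) e
lemma4p8 k 2≤k cs _ m (_ , m-annihilates , _) l 1≤l _ gcd≡1 e (_ , m∣lᵉ∸1 , _) r s ofType isCI kIf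
  with ofType⇒e≡zOrder ofType
... | r₀ , s₀ , r₀≤r , s₀≤s , refl with zOrder-split r₀≤r s₀≤s
...   | inj₁ n≡e = subst (HasOrder (H cs r s l) (zGen cs r s l)) n≡e (HProperties.zGen-hasOrder cs r s l)
...   | inj₂ (p , h , p∈ , n≡p*h , e∣h) =
  ⊥-elim (CI∧kIf⇒¬FixedUpToInverse (H cs r s l) isCI 2≤k kIf
            zʰ-≢ε (zPow-⁻¹-involutive _) zʰ-fixedUpToInverse)
  where
  moduli∣m : All (λ c → modulus c ∣ m) cs
  moduli∣m = annihilator⇒modulus∣ m-annihilates
  coprime : All (λ c → Coprime (modulus c) (l ∸ 1)) cs
  coprime = All.map (λ {c} → modulus⊥l∸1 {c}) moduli∣m
    where
    modulus⊥l∸1 : ∀ {c} → modulus c ∣ m → Coprime (modulus c) (l ∸ 1)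
    modulus⊥l∸1 q∣m = coprime-∣ q∣m (n∣m*n l) (coprime-sym (gcd≡1⇒coprime gcd≡1))
  lʰ-trivial : ∀ (y : Elt cs) → smulM (l ^ h) y ≡ y
  lʰ-trivial = smulM-identity (All.map (λ {c} → lʰ≡1-mod {c}) moduli∣m)
    where
    lʰ≡1-mod : ∀ {c} → modulus c ∣ m → (l ^ h) ≡1-mod c
    lʰ≡1-mod {c} q∣m = d∣aᵉ∸1∧e∣h⇒aʰ%d≡1%d {{modulus-nonZero c}} 1≤l (∣-trans q∣m m∣lᵉ∸1) e∣h
  open HProperties cs r s l
  open Zʰ 1≤l coprime p∈ n≡p*h lʰ-trivial
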